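{- Let $k$ be a positive integer, $\vec{s}=(s_1,\ldots,s_b)$ a vector of nonnegative integers with $s_i\le k$, and $s=\sum_{i=1}^b s_i$. Let $X^{(k,\vec{s})}$ be the number of empty urns at the end of the Grouped Urn $(k,\vec{s})$-model and $Y^{(k,s)}$ the number of empty urns at the end of the Classical Urn $(k,s)$-model. Then for every $t\ge 0$, \[\Pr[X^{(k,\vec{s})}\ge t]\le \Pr[Y^{(k,s)}\ge t].\]
   Context: There are $k$ distinguishable urns indexed by $[k]=\{1,\ldots,k\}$. Grouped Urn $(k,\vec{s})$-model: choose subsets $S_1,\ldots,S_b\subseteq[k]$ independently, $S_i$ uniformly among all subsets of $[k]$ of size $s_i$, and for each $i$ and each $j\in S_i$ place one ball in urn $j$ (so $s$ balls are placed in total). Classical Urn $(k,s)$-model: place $s$ balls, each into an urn chosen uniformly from the $k$ urns, independently of the other balls. -}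

module Defs where

open import Data.Bool using (Bool; true; false; _∧_; not; if_then_else_)
open import Data.Nat using (ℕ; zero; suc; _≤ᵇ_; _≡ᵇ_)
open import Data.Fin using (Fin)
open import Data.Fin.Subset using (Subset; ∣_∣)
open import Data.List using (List; []; _∷_; map; concatMap; filter; length; allFin)
open import Data.Vec using (Vec; []; _∷_; lookup)
import Data.Vec as V
open import Data.Integer using (+_)
open import Data.Rational using (ℚ; _/_; 0ℚ)
open import Relation.Nullary.Decidable using (⌊_⌋)
open import Relation.Nullary using (does)
import Data.List.Relation.Unary.All as LAll

countᵇ : {A : Set} → (A → Bool) → List A → ℕ
countᵇ p [] = 0
countᵇ p (x ∷ xs) = if p x then suc (countᵇ p xs) else countᵇ p xs

-- Probability of event P under the uniform distribution on a finite list of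
-- (equally likely) outcomes: (#outcomes satisfying P) / (#outcomes).
-- (Convention 0 for an empty sample space; never used here since all the
-- sample spaces below are nonempty under the hypotheses.)
probU : {A : Set} → List A → (A → Bool) → ℚ
probU L P with length L
... | zero = 0ℚ
... | suc n = (+ countᵇ P L) / suc n

allSubsets : (k : ℕ) → List (Subset k)
allSubsets zero = [] ∷ []
allSubsets (suc k) = concatMap (λ S → (true ∷ S) ∷ (false ∷ S) ∷ []) (allSubsets k)

subsetsOfSize : (k m : ℕ) → List (Subset k)
subsetsOfSize k m = filter (λ S → m Data.Nat.≟ ∣ S ∣) (allSubsets k)

-- sample space of the Grouped Urn (k, s⃗)-model: all tuples (S₁,…,S_b)
-- with |S_i| = s_i, uniformly distributed (product of uniform choices)
groupedOutcomes : (k : ℕ) {b : ℕ} → Vec ℕ b → List (Vec (Subset k) b)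
groupedOutcomes k [] = [] ∷ []
groupedOutcomes k (m ∷ ms) =
  concatMap (λ S → map (S ∷_) (groupedOutcomes k ms)) (subsetsOfSize k m)

emptyGrouped : {k b : ℕ} → Vec (Subset k) b → ℕ
emptyGrouped {k} Ss = countᵇ (λ j → V.foldr _ (λ S acc → not (lookup S j) ∧ acc) true Ss) (allFin k)

-- sample space of the Classical Urn (k, s)-model: all assignments of the
-- s balls to urns (ball i goes to urn f i), uniformly distributed
classicalOutcomes : (k s : ℕ) → List (Vec (Fin k) s)
classicalOutcomes k zero = [] ∷ []
classicalOutcomes k (suc s) =
  concatMap (λ j → map (j ∷_) (classicalOutcomes k s)) (allFin k)

emptyClassical : {k s : ℕ} → Vec (Fin k) s → ℕ
emptyClassical {k} f = countᵇ (λ j → V.foldr _ (λ u acc → not ⌊ Data.Fin._≟_ u j ⌋ ∧ acc) true f) (allFin k)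

PrX≥ : (k : ℕ) {b : ℕ} → Vec ℕ b → ℕ → ℚ
PrX≥ k s t = probU (groupedOutcomes k s) (λ o → t ≤ᵇ emptyGrouped o)

PrY≥ : (k s : ℕ) → ℕ → ℚ
PrY≥ k s t = probU (classicalOutcomes k s) (λ o → t ≤ᵇ emptyClassical o)

-- Both probabilities are averages, over the respective sample spaces, of the
-- indicator that the set B of occupied urns has at least t elements outside it,
-- an antitone function of B; so it suffices to compare the grouped and classical
-- averages of an arbitrary antitone ψ.  For a single group of size m induct on m:
-- a uniform m-subset S together with a uniform urn j gives ⁅ j ⁆ ∪ S, which is a
-- uniform m-subset with probability m/k and a uniform (m+1)-subset otherwise.
-- Double counting shows that the (m+1)-subset average of ψ is at most the m-subset
-- average, hence at most the average of ψ (⁅ j ⁆ ∪ S), which by induction is at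
-- most the classical average with m+1 balls.  Groups are then added one at a time,
-- since m + n classical balls occupy the union of the urns hit by the first m and
-- by the last n balls.

module Submission where

open import Defs
open import Data.Nat using (ℕ; _≤_)
open import Data.Vec using (Vec; sum)
open import Data.Vec.Relation.Unary.All using (All)
open import Data.Rational using () renaming (_≤_ to _≤ℚ_)

open import Data.Bool using (Bool; true; false; not; _∧_; _∨_; if_then_else_; T)
open import Data.Fin using (Fin; zero; suc)
import Data.Fin as Fin
open import Data.Fin.Subset using (Subset; ⊥; ⁅_⁆; _∪_; ∁; _∈_; _∉_; _⊆_; ∣_∣; ⋃; inside; outside)
open import Data.Fin.Subset.Properties
  using ( ∪-assoc; ∪-identityˡ; q⊆p∪q; x∈p∪q⁻; x∈p∪q⁺; x∈⁅y⁆⇒x≡y; ⊆-antisym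
        ; p⊆q⇒∣p∣≤∣q∣; p⊆q⇒∁p⊇∁q)
open import Data.List using (List; []; _∷_; map; concatMap; filter; length; allFin; _++_)
open import Data.List.Properties using (map-tabulate; length-tabulate)
import Data.List.Relation.Unary.All as List
open import Data.List.Relation.Unary.All.Properties using (all-filter)
open import Data.Nat
  using (zero; suc; _+_; _*_; _^_; _<_; _≤ᵇ_; _≡ᵇ_; z≤n; s≤s; NonZero; >-nonZero)
open import Data.Nat.Properties
open import Data.Nat.Tactic.RingSolver using (solve-∀)
open import Algebra.Properties.CommutativeSemigroup +-commutativeSemigroup using (interchange)
open import Algebra.Properties.CommutativeSemigroup *-commutativeSemigroup using (x∙yz≈y∙xz)
import Data.Sum as Sum
import Data.Integer as ℤ
import Data.Integer.Properties as ℤ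
open import Data.Rational using (_/_)
import Data.Rational.Properties as ℚ
open import Data.Rational.Unnormalised using (mkℚᵘ; *≤*)
import Data.Rational.Unnormalised.Properties as ℚᵘ
open import Data.Vec using (_∷_; []; lookup; toList; foldr; here; there)
open import Data.Vec.Relation.Unary.All using (_∷_; [])
import Data.Vec.Properties as Vec
open import Function using (_∘_; id; const)
open import Relation.Binary.PropositionalEquality
open import Relation.Nullary using (Dec; does; yes; no; contradiction)
open import Relation.Nullary.Decidable using (⌊_⌋)

∑ : {A : Set} → List A → (A → ℕ) → ℕ
∑ []       f = 0
∑ (x ∷ xs) f = f x + ∑ xs f

syntax ∑ L (λ x → e) = ∑[ x ∈ L ] e

when : Bool → ℕ → ℕ
when b n = if b then n else 0

when-monoʳ : ∀ b {x y} → x ≤ y → when b x ≤ when b y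
when-monoʳ true  x≤y = x≤y
when-monoʳ false _   = z≤n

module _ {A : Set} where

  ∑-cong : (L : List A) {f g : A → ℕ} → (∀ x → f x ≡ g x) → ∑ L f ≡ ∑ L g
  ∑-cong []      f≗g = refl
  ∑-cong (x ∷ L) f≗g = cong₂ _+_ (f≗g x) (∑-cong L f≗g)

  ∑-congᴬ : {P : A → Set} {L : List A} {f g : A → ℕ} →
            List.All P L → (∀ {x} → P x → f x ≡ g x) → ∑ L f ≡ ∑ L g
  ∑-congᴬ List.[]         f≗g = refl
  ∑-congᴬ (px List.∷ pxs) f≗g = cong₂ _+_ (f≗g px) (∑-congᴬ pxs f≗g)

  ∑-mono : (L : List A) {f g : A → ℕ} → (∀ x → f x ≤ g x) → ∑ L f ≤ ∑ L g
  ∑-mono []      f≤g = z≤n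
  ∑-mono (x ∷ L) f≤g = +-mono-≤ (f≤g x) (∑-mono L f≤g)

  ∑-++ : (L M : List A) (f : A → ℕ) → ∑ (L ++ M) f ≡ ∑ L f + ∑ M f
  ∑-++ []      M f = refl
  ∑-++ (x ∷ L) M f = trans (cong (f x +_) (∑-++ L M f)) (sym (+-assoc (f x) _ _))

  ∑-+ : (L : List A) (f g : A → ℕ) → ∑[ x ∈ L ] (f x + g x) ≡ ∑ L f + ∑ L g
  ∑-+ []      f g = refl
  ∑-+ (x ∷ L) f g = trans (cong (f x + g x +_) (∑-+ L f g)) (interchange (f x) (g x) _ _)

  ∑-*ˡ : (L : List A) (c : ℕ) (f : A → ℕ) → ∑[ x ∈ L ] (c * f x) ≡ c * ∑ L f
  ∑-*ˡ []      c f = sym (*-zeroʳ c)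
  ∑-*ˡ (x ∷ L) c f = trans (cong (c * f x +_) (∑-*ˡ L c f)) (sym (*-distribˡ-+ c (f x) _))

  ∑-*ʳ : (L : List A) (c : ℕ) (f : A → ℕ) → ∑[ x ∈ L ] (f x * c) ≡ ∑ L f * c
  ∑-*ʳ L c f = trans (∑-cong L (λ x → *-comm (f x) c)) (trans (∑-*ˡ L c f) (*-comm c (∑ L f)))

  ∑-const : (L : List A) (c : ℕ) → ∑[ _ ∈ L ] c ≡ length L * c
  ∑-const []      c = refl
  ∑-const (x ∷ L) c = cong (c +_) (∑-const L c)

  ∑-1 : (L : List A) → ∑[ _ ∈ L ] 1 ≡ length L
  ∑-1 L = trans (∑-const L 1) (*-identityʳ (length L))

  ∑-filter : {P : A → Set} (P? : ∀ x → Dec (P x)) (L : List A) (f : A → ℕ) →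
             ∑ (filter P? L) f ≡ ∑[ x ∈ L ] when (does (P? x)) (f x)
  ∑-filter P? []      f = refl
  ∑-filter P? (x ∷ L) f with does (P? x)
  ... | true  = cong (f x +_) (∑-filter P? L f)
  ... | false = ∑-filter P? L f

  ∑-when : (b : Bool) (L : List A) (f : A → ℕ) → when b (∑ L f) ≡ ∑[ x ∈ L ] when b (f x)
  ∑-when true  L f = refl
  ∑-when false L f = sym (trans (∑-const L 0) (*-zeroʳ (length L)))

  countᵇ≡∑ : (p : A → Bool) (L : List A) → countᵇ p L ≡ ∑[ x ∈ L ] when (p x) 1
  countᵇ≡∑ p []      = refl
  countᵇ≡∑ p (x ∷ L) with p x
  ... | true  = cong suc (countᵇ≡∑ p L)
  ... | false = countᵇ≡∑ p L

module _ {A B : Set} where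

  ∑-map : (h : A → B) (L : List A) (f : B → ℕ) → ∑ (map h L) f ≡ ∑ L (f ∘ h)
  ∑-map h []      f = refl
  ∑-map h (x ∷ L) f = cong (f (h x) +_) (∑-map h L f)

  ∑-concatMap : (h : A → List B) (L : List A) (f : B → ℕ) →
                ∑ (concatMap h L) f ≡ ∑[ x ∈ L ] ∑ (h x) f
  ∑-concatMap h []      f = refl
  ∑-concatMap h (x ∷ L) f = trans (∑-++ (h x) (concatMap h L) f) (cong (∑ (h x) f +_) (∑-concatMap h L f))

  ∑-comm : (L : List A) (M : List B) (f : A → B → ℕ) →
           ∑[ x ∈ L ] ∑[ y ∈ M ] f x y ≡ ∑[ y ∈ M ] ∑[ x ∈ L ] f x y
  ∑-comm []      M f = sym (trans (∑-const M 0) (*-zeroʳ (length M)))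
  ∑-comm (x ∷ L) M f = trans (cong (∑ M (f x) +_) (∑-comm L M f)) (sym (∑-+ M (f x) _))

∑-allFin-suc : ∀ n (f : Fin (suc n) → ℕ) → ∑ (allFin (suc n)) f ≡ f zero + ∑ (allFin n) (f ∘ suc)
∑-allFin-suc n f = cong (f zero +_)
  (trans (cong (λ L → ∑ L f) (sym (map-tabulate id suc))) (∑-map suc (allFin n) f))

∑-allSubsets-suc : ∀ k (f : Subset (suc k) → ℕ) →
  ∑ (allSubsets (suc k)) f ≡ ∑[ S ∈ allSubsets k ] (f (inside ∷ S) + f (outside ∷ S))
∑-allSubsets-suc k f = trans (∑-concatMap _ (allSubsets k) f)
  (∑-cong (allSubsets k) (λ S → cong (f (inside ∷ S) +_) (+-identityʳ _)))

∑-subsetsOfSize : ∀ k m (ψ : Subset k → ℕ) →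
  ∑ (subsetsOfSize k m) ψ ≡ ∑[ S ∈ allSubsets k ] when (m ≡ᵇ ∣ S ∣) (ψ S)
∑-subsetsOfSize k m = ∑-filter (λ S → m ≟ ∣ S ∣) (allSubsets k)

∑-subsetsOfSize-cong : ∀ k m {ψ φ : Subset k → ℕ} → (∀ {S} → m ≡ ∣ S ∣ → ψ S ≡ φ S) →
  ∑ (subsetsOfSize k m) ψ ≡ ∑ (subsetsOfSize k m) φ
∑-subsetsOfSize-cong k m = ∑-congᴬ (all-filter (λ S → m ≟ ∣ S ∣) (allSubsets k))

lookup-⊥ : ∀ {k} (j : Fin k) → lookup ⊥ j ≡ false
lookup-⊥ j = Vec.lookup-replicate j outside

lookup-∪ : ∀ {k} (p q : Subset k) (j : Fin k) → lookup (p ∪ q) j ≡ lookup p j ∨ lookup q j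
lookup-∪ p q j = Vec.lookup-zipWith _∨_ j p q

lookup-⁅⁆ : ∀ {k} (i j : Fin k) → lookup ⁅ i ⁆ j ≡ ⌊ i Fin.≟ j ⌋
lookup-⁅⁆ zero    zero    = refl
lookup-⁅⁆ zero    (suc j) = lookup-⊥ j
lookup-⁅⁆ (suc i) zero    = refl
lookup-⁅⁆ (suc i) (suc j) with i Fin.≟ j | lookup-⁅⁆ i j
... | yes _ | ⁅i⁆[j] = ⁅i⁆[j]
... | no _  | ⁅i⁆[j] = ⁅i⁆[j]

lookup≡false⇒∉ : ∀ {k} {S : Subset k} {j} → lookup S j ≡ false → j ∉ S
lookup≡false⇒∉ S[j]≡false j∈S with () ← trans (sym (Vec.[]=⇒lookup j∈S)) S[j]≡false

∪-mono-⊆ : ∀ {k} {p p′ q q′ : Subset k} → p ⊆ p′ → q ⊆ q′ → p ∪ q ⊆ p′ ∪ q′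
∪-mono-⊆ p⊆p′ q⊆q′ x∈p∪q = x∈p∪q⁺ (Sum.map p⊆p′ q⊆q′ (x∈p∪q⁻ _ _ x∈p∪q))

x∈p⇒⁅x⁆∪p≡p : ∀ {k} {x : Fin k} {p} → x ∈ p → ⁅ x ⁆ ∪ p ≡ p
x∈p⇒⁅x⁆∪p≡p {x = x} {p} x∈p = ⊆-antisym ⁅x⁆∪p⊆p (q⊆p∪q ⁅ x ⁆ p)
  where
  ⁅x⁆∪p⊆p : ⁅ x ⁆ ∪ p ⊆ p
  ⁅x⁆∪p⊆p y∈ = Sum.[ (λ y∈⁅x⁆ → subst (_∈ p) (sym (x∈⁅y⁆⇒x≡y x y∈⁅x⁆)) x∈p) , id ]
                     (x∈p∪q⁻ ⁅ x ⁆ p y∈)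

x∉p⇒∣⁅x⁆∪p∣≡1+∣p∣ : ∀ {k} {x : Fin k} {p} → x ∉ p → ∣ ⁅ x ⁆ ∪ p ∣ ≡ suc ∣ p ∣
x∉p⇒∣⁅x⁆∪p∣≡1+∣p∣ {x = zero}  {outside ∷ p} _   = cong (suc ∘ ∣_∣) (∪-identityˡ p)
x∉p⇒∣⁅x⁆∪p∣≡1+∣p∣ {x = zero}  {inside ∷ p}  x∉p = contradiction here x∉p
x∉p⇒∣⁅x⁆∪p∣≡1+∣p∣ {x = suc x} {inside ∷ p}  x∉p = cong suc (x∉p⇒∣⁅x⁆∪p∣≡1+∣p∣ (x∉p ∘ there))
x∉p⇒∣⁅x⁆∪p∣≡1+∣p∣ {x = suc x} {outside ∷ p} x∉p = x∉p⇒∣⁅x⁆∪p∣≡1+∣p∣ (x∉p ∘ there)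

∑∈ ∑∉ : ∀ {k} → Subset k → (Fin k → ℕ) → ℕ
∑∈ {k} S f = ∑[ j ∈ allFin k ] when (lookup S j) (f j)
∑∉ {k} S f = ∑[ j ∈ allFin k ] when (not (lookup S j)) (f j)

syntax ∑∉ S (λ j → e) = ∑[ j ∉ S ] e

∑∈-∷ : ∀ {k} b (S : Subset k) (f : Fin (suc k) → ℕ) →
  ∑∈ (b ∷ S) f ≡ when b (f zero) + ∑∈ S (f ∘ suc)
∑∈-∷ {k} b S f = ∑-allFin-suc k (λ j → when (lookup (b ∷ S) j) (f j))

∑∉-∷ : ∀ {k} b (S : Subset k) (f : Fin (suc k) → ℕ) →
  ∑∉ (b ∷ S) f ≡ when (not b) (f zero) + ∑∉ S (f ∘ suc)
∑∉-∷ {k} b S f = ∑-allFin-suc k (λ j → when (not (lookup (b ∷ S) j)) (f j))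

∑-allFin≡∑∈+∑∉ : ∀ {k} (S : Subset k) (f : Fin k → ℕ) → ∑ (allFin k) f ≡ ∑∈ S f + ∑∉ S f
∑-allFin≡∑∈+∑∉ {k} S f = trans (∑-cong (allFin k) (λ j → split (lookup S j) (f j))) (∑-+ (allFin k) _ _)
  where
  split : ∀ b n → n ≡ when b n + when (not b) n
  split true  n = sym (+-identityʳ n)
  split false n = refl

∑∈-const : ∀ {k} (S : Subset k) (c : ℕ) → ∑∈ S (const c) ≡ ∣ S ∣ * c
∑∈-const []                    c = refl
∑∈-const (inside ∷ S)  c = trans (∑∈-∷ inside S (const c)) (cong (c +_) (∑∈-const S c))
∑∈-const (outside ∷ S) c = trans (∑∈-∷ outside S (const c)) (∑∈-const S c)

∑∈-cong : ∀ {k} (S : Subset k) {f g : Fin k → ℕ} →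
  (∀ {j} → j ∈ S → f j ≡ g j) → ∑∈ S f ≡ ∑∈ S g
∑∈-cong {k} S {f} {g} f≗g = ∑-cong (allFin k) pointwise
  where
  pointwise : ∀ j → when (lookup S j) (f j) ≡ when (lookup S j) (g j)
  pointwise j with lookup S j in S[j]
  ... | true  = f≗g (Vec.lookup⇒[]= j S S[j])
  ... | false = refl

∑∉-const : ∀ {k} (S : Subset k) (c : ℕ) → ∑∉ S (const c) + ∣ S ∣ * c ≡ k * c
∑∉-const {k} S c = begin
  ∑∉ S (const c) + ∣ S ∣ * c      ≡⟨ +-comm _ (∣ S ∣ * c) ⟩
  ∣ S ∣ * c + ∑∉ S (const c)      ≡⟨ cong (_+ ∑∉ S (const c)) (∑∈-const S c) ⟨
  ∑∈ S (const c) + ∑∉ S (const c) ≡⟨ ∑-allFin≡∑∈+∑∉ S (const c) ⟨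
  ∑ (allFin k) (const c)          ≡⟨ ∑-const (allFin k) c ⟩
  length (allFin k) * c           ≡⟨ cong (_* c) (length-tabulate {n = k} id) ⟩
  k * c                           ∎
  where open ≡-Reasoning

∑-insert : ∀ {k} (ψ : Subset k → ℕ) (S : Subset k) →
  ∑[ j ∈ allFin k ] ψ (⁅ j ⁆ ∪ S) ≡ ∣ S ∣ * ψ S + ∑[ j ∉ S ] ψ (⁅ j ⁆ ∪ S)
∑-insert ψ S = trans (∑-allFin≡∑∈+∑∉ S _)
  (cong (_+ ∑[ j ∉ S ] ψ (⁅ j ⁆ ∪ S))
    (trans (∑∈-cong S (cong ψ ∘ x∈p⇒⁅x⁆∪p≡p)) (∑∈-const S (ψ S))))

-- Each U arises as ⁅ j ⁆ ∪ S from exactly ∣ U ∣ pairs (S , j) with j ∉ S.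
insertion-double-count : ∀ k (G : Subset k → ℕ) →
  ∑[ S ∈ allSubsets k ] ∑[ j ∉ S ] G (⁅ j ⁆ ∪ S) ≡ ∑[ U ∈ allSubsets k ] (∣ U ∣ * G U)
insertion-double-count zero    G = refl
insertion-double-count (suc k) G = begin
  ∑[ S ∈ allSubsets (suc k) ] ∑[ j ∉ S ] G (⁅ j ⁆ ∪ S)
    ≡⟨ ∑-allSubsets-suc k _ ⟩
  ∑[ S ∈ all ] (∑[ j ∉ inside ∷ S ] G (⁅ j ⁆ ∪ (inside ∷ S))
                + ∑[ j ∉ outside ∷ S ] G (⁅ j ⁆ ∪ (outside ∷ S)))
    ≡⟨ ∑-cong all (λ S → cong₂ _+_ (∑∉-∷ inside S _) (∑∉-∷ outside S _)) ⟩
  ∑[ S ∈ all ] (X₁ S + (G₁ (⊥ ∪ S) + X₀ S))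
    ≡⟨ ∑-cong all (λ S → cong (λ U → X₁ S + (G₁ U + X₀ S)) (∪-identityˡ S)) ⟩
  ∑[ S ∈ all ] (X₁ S + (G₁ S + X₀ S))
    ≡⟨ ∑-cong all (λ S → trans (sym (+-assoc (X₁ S) _ _)) (cong (_+ X₀ S) (+-comm (X₁ S) (G₁ S)))) ⟩
  ∑[ S ∈ all ] (G₁ S + X₁ S + X₀ S)
    ≡⟨ ∑-+₃ G₁ X₁ X₀ ⟩
  ∑ all G₁ + ∑ all X₁ + ∑ all X₀
    ≡⟨ cong₂ (λ x y → ∑ all G₁ + x + y) (insertion-double-count k G₁) (insertion-double-count k G₀) ⟩
  ∑ all G₁ + ∑[ U ∈ all ] (∣ U ∣ * G₁ U) + ∑[ U ∈ all ] (∣ U ∣ * G₀ U)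
    ≡⟨ ∑-+₃ G₁ (λ U → ∣ U ∣ * G₁ U) (λ U → ∣ U ∣ * G₀ U) ⟨
  ∑[ U ∈ all ] (∣ inside ∷ U ∣ * G₁ U + ∣ outside ∷ U ∣ * G₀ U)
    ≡⟨ ∑-allSubsets-suc k (λ U → ∣ U ∣ * G U) ⟨
  ∑[ U ∈ allSubsets (suc k) ] (∣ U ∣ * G U) ∎
  where
  open ≡-Reasoning
  all = allSubsets k
  G₁ G₀ X₁ X₀ : Subset k → ℕ
  G₁ U = G (inside ∷ U)
  G₀ U = G (outside ∷ U)
  X₁ S = ∑[ j ∉ S ] G₁ (⁅ j ⁆ ∪ S)
  X₀ S = ∑[ j ∉ S ] G₀ (⁅ j ⁆ ∪ S)
  ∑-+₃ : (f g h : Subset k → ℕ) → ∑[ S ∈ all ] (f S + g S + h S) ≡ ∑ all f + ∑ all g + ∑ all h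
  ∑-+₃ f g h = trans (∑-+ all _ h) (cong (_+ ∑ all h) (∑-+ all f g))

∑-subsetsOfSize-zero : ∀ k (ψ : Subset k → ℕ) → ∑ (subsetsOfSize k 0) ψ ≡ ψ ⊥
∑-subsetsOfSize-zero zero    ψ = +-identityʳ (ψ [])
∑-subsetsOfSize-zero (suc k) ψ = begin
  ∑ (subsetsOfSize (suc k) 0) ψ
    ≡⟨ ∑-subsetsOfSize (suc k) 0 ψ ⟩
  ∑[ S ∈ allSubsets (suc k) ] when (0 ≡ᵇ ∣ S ∣) (ψ S)
    ≡⟨ ∑-allSubsets-suc k _ ⟩
  ∑[ S ∈ allSubsets k ] when (0 ≡ᵇ ∣ S ∣) (ψ (outside ∷ S))
    ≡⟨ ∑-subsetsOfSize k 0 (ψ ∘ (outside ∷_)) ⟨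
  ∑ (subsetsOfSize k 0) (ψ ∘ (outside ∷_))
    ≡⟨ ∑-subsetsOfSize-zero k (ψ ∘ (outside ∷_)) ⟩
  ψ ⊥ ∎
  where open ≡-Reasoning

∑-∑∉-const : ∀ k m (φ : Subset k → ℕ) →
  ∑[ S ∈ subsetsOfSize k m ] ∑∉ S (const (φ S)) + m * ∑ (subsetsOfSize k m) φ ≡ k * ∑ (subsetsOfSize k m) φ
∑-∑∉-const k m φ = begin
  ∑[ S ∈ Sₘ ] ∑∉ S (const (φ S)) + m * ∑ Sₘ φ
    ≡⟨ cong (∑[ S ∈ Sₘ ] ∑∉ S (const (φ S)) +_) (∑-*ˡ Sₘ m φ) ⟨
  ∑[ S ∈ Sₘ ] ∑∉ S (const (φ S)) + ∑[ S ∈ Sₘ ] (m * φ S)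
    ≡⟨ ∑-+ Sₘ _ _ ⟨
  ∑[ S ∈ Sₘ ] (∑∉ S (const (φ S)) + m * φ S)
    ≡⟨ ∑-subsetsOfSize-cong k m (λ {S} m≡∣S∣ →
         subst (λ n → ∑∉ S (const (φ S)) + n * φ S ≡ k * φ S) (sym m≡∣S∣) (∑∉-const S (φ S))) ⟩
  ∑[ S ∈ Sₘ ] (k * φ S)
    ≡⟨ ∑-*ˡ Sₘ k φ ⟩
  k * ∑ Sₘ φ ∎
  where
  open ≡-Reasoning
  Sₘ = subsetsOfSize k m

∑-∑-insert : ∀ k m (ψ : Subset k → ℕ) →
  ∑[ S ∈ subsetsOfSize k m ] ∑[ j ∈ allFin k ] ψ (⁅ j ⁆ ∪ S)
  ≡ m * ∑ (subsetsOfSize k m) ψ + ∑[ S ∈ subsetsOfSize k m ] ∑[ j ∉ S ] ψ (⁅ j ⁆ ∪ S)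
∑-∑-insert k m ψ = trans
  (∑-subsetsOfSize-cong k m (λ {S} m≡∣S∣ →
    trans (∑-insert ψ S) (cong (λ n → n * ψ S + ∑[ j ∉ S ] ψ (⁅ j ⁆ ∪ S)) (sym m≡∣S∣))))
  (trans (∑-+ (subsetsOfSize k m) _ _)
    (cong (_+ ∑[ S ∈ subsetsOfSize k m ] ∑[ j ∉ S ] ψ (⁅ j ⁆ ∪ S)) (∑-*ˡ (subsetsOfSize k m) m ψ)))

∑-∑∉-insert : ∀ k m (ψ : Subset k → ℕ) →
  ∑[ S ∈ subsetsOfSize k m ] ∑[ j ∉ S ] ψ (⁅ j ⁆ ∪ S) ≡ suc m * ∑ (subsetsOfSize k (suc m)) ψ
∑-∑∉-insert k m ψ = begin
  ∑[ S ∈ subsetsOfSize k m ] ∑[ j ∉ S ] ψ (⁅ j ⁆ ∪ S)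
    ≡⟨ ∑-subsetsOfSize k m _ ⟩
  ∑[ S ∈ all ] when (m ≡ᵇ ∣ S ∣) (∑[ j ∉ S ] ψ (⁅ j ⁆ ∪ S))
    ≡⟨ ∑-cong all (λ S → trans (∑-when _ (allFin k) _) (∑-cong (allFin k) (restrict S))) ⟩
  ∑[ S ∈ all ] ∑[ j ∉ S ] G (⁅ j ⁆ ∪ S)
    ≡⟨ insertion-double-count k G ⟩
  ∑[ U ∈ all ] (∣ U ∣ * G U)
    ≡⟨ ∑-cong all (λ U → size (∣ U ∣) (ψ U)) ⟩
  ∑[ U ∈ all ] (suc m * G U)
    ≡⟨ ∑-*ˡ all (suc m) G ⟩
  suc m * ∑ all G
    ≡⟨ cong (suc m *_) (∑-subsetsOfSize k (suc m) ψ) ⟨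
  suc m * ∑ (subsetsOfSize k (suc m)) ψ ∎
  where
  open ≡-Reasoning
  all = allSubsets k
  G : Subset k → ℕ
  G U = when (suc m ≡ᵇ ∣ U ∣) (ψ U)
  restrict : ∀ S j → when (m ≡ᵇ ∣ S ∣) (when (not (lookup S j)) (ψ (⁅ j ⁆ ∪ S)))
                   ≡ when (not (lookup S j)) (G (⁅ j ⁆ ∪ S))
  restrict S j with lookup S j in S[j]
  ... | false rewrite x∉p⇒∣⁅x⁆∪p∣≡1+∣p∣ (lookup≡false⇒∉ {S = S} S[j]) = refl
  ... | true with m ≡ᵇ ∣ S ∣
  ...   | true  = refl
  ...   | false = refl
  size : ∀ n x → n * when (suc m ≡ᵇ n) x ≡ suc m * when (suc m ≡ᵇ n) x
  size n x with suc m ≡ᵇ n in m+1≡n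
  ... | true  = cong (_* x) (sym (≡ᵇ⇒≡ (suc m) n (subst T (sym m+1≡n) _)))
  ... | false = trans (*-zeroʳ n) (sym (*-zeroʳ (suc m)))

Antitone : ∀ {k} → (Subset k → ℕ) → Set
Antitone ψ = ∀ {p q} → p ⊆ q → ψ q ≤ ψ p

antitone-∪ˡ : ∀ {k} {ψ : Subset k → ℕ} → Antitone ψ → ∀ S → Antitone (λ B → ψ (S ∪ B))
antitone-∪ˡ anti S p⊆q = anti (∪-mono-⊆ (λ x∈S → x∈S) p⊆q)

-- The hypotheses give q′/c′ ≤ q/c, so q′/c′ is at most the mediant
-- (m q + (m+1) q′) / (m c + (m+1) c′) = (m q + (m+1) q′) / (k c).
ratio≤mediant : ∀ m k q q′ c c′ → suc m * q′ + m * q ≤ k * q → suc m * c′ + m * c ≡ k * c →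
  q′ * (k * c) ≤ c′ * (m * q + suc m * q′)
ratio≤mediant m k q q′ c c′ hq hc = begin
  q′ * (k * c)                        ≡⟨ cong (q′ *_) hc ⟨
  q′ * (suc m * c′ + m * c)           ≡⟨ expand₁ m q′ c c′ ⟩
  suc m * q′ * c′ + m * (q′ * c)      ≤⟨ +-monoʳ-≤ (suc m * q′ * c′) (*-monoʳ-≤ m q′c≤c′q) ⟩
  suc m * q′ * c′ + m * (c′ * q)      ≡⟨ expand₂ m q q′ c′ ⟨
  c′ * (m * q + suc m * q′)           ∎
  where
  open ≤-Reasoning
  expand₁ : ∀ m q′ c c′ → q′ * (suc m * c′ + m * c) ≡ suc m * q′ * c′ + m * (q′ * c)
  expand₁ = solve-∀
  expand₂ : ∀ m q q′ c′ → c′ * (m * q + suc m * q′) ≡ suc m * q′ * c′ + m * (c′ * q)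
  expand₂ = solve-∀
  expand₃ : ∀ m q q′ c → (suc m * q′ + m * q) * c ≡ suc m * (q′ * c) + m * q * c
  expand₃ = solve-∀
  expand₄ : ∀ m q c c′ → q * (suc m * c′ + m * c) ≡ suc m * (c′ * q) + m * q * c
  expand₄ = solve-∀
  rotate : ∀ k q c → k * q * c ≡ q * (k * c)
  rotate = solve-∀
  q′c≤c′q : q′ * c ≤ c′ * q
  q′c≤c′q = *-cancelˡ-≤ (suc m) (+-cancelʳ-≤ (m * q * c) _ _ (begin
    suc m * (q′ * c) + m * q * c      ≡⟨ expand₃ m q q′ c ⟨
    (suc m * q′ + m * q) * c          ≤⟨ *-monoˡ-≤ c hq ⟩
    k * q * c                         ≡⟨ rotate k q c ⟩
    q * (k * c)                       ≡⟨ cong (q *_) hc ⟨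
    q * (suc m * c′ + m * c)          ≡⟨ expand₄ m q c c′ ⟩
    suc m * (c′ * q) + m * q * c      ∎))

length-subsetsOfSize-suc : ∀ k m →
  suc m * length (subsetsOfSize k (suc m)) + m * length (subsetsOfSize k m) ≡ k * length (subsetsOfSize k m)
length-subsetsOfSize-suc k m = begin
  suc m * c′ + m * c
    ≡⟨ cong₂ (λ x y → suc m * x + m * y) (∑-1 (subsetsOfSize k (suc m))) (∑-1 (subsetsOfSize k m)) ⟨
  suc m * ∑[ _ ∈ subsetsOfSize k (suc m) ] 1 + m * ∑[ _ ∈ subsetsOfSize k m ] 1
    ≡⟨ cong (_+ m * ∑[ _ ∈ subsetsOfSize k m ] 1) (∑-∑∉-insert k m (const 1)) ⟨
  ∑[ S ∈ subsetsOfSize k m ] ∑∉ S (const 1) + m * ∑[ _ ∈ subsetsOfSize k m ] 1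
    ≡⟨ ∑-∑∉-const k m (const 1) ⟩
  k * ∑[ _ ∈ subsetsOfSize k m ] 1
    ≡⟨ cong (k *_) (∑-1 (subsetsOfSize k m)) ⟩
  k * c ∎
  where
  open ≡-Reasoning
  c = length (subsetsOfSize k m)
  c′ = length (subsetsOfSize k (suc m))

length-subsetsOfSize-zero : ∀ k → length (subsetsOfSize k 0) ≡ 1
length-subsetsOfSize-zero k = trans (sym (∑-1 (subsetsOfSize k 0))) (∑-subsetsOfSize-zero k (const 1))

length-subsetsOfSize-pos : ∀ k m → m ≤ k → 0 < length (subsetsOfSize k m)
length-subsetsOfSize-pos k zero    _   = ≤-reflexive (sym (length-subsetsOfSize-zero k))
length-subsetsOfSize-pos k (suc m) m<k = n≢0⇒n>0 λ c′≡0 → <-irrefl (mc≡kc c′≡0) mc<kc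
  where
  c = length (subsetsOfSize k m)
  instance
    c≢0 : NonZero c
    c≢0 = >-nonZero (length-subsetsOfSize-pos k m (<⇒≤ m<k))
  mc<kc : m * c < k * c
  mc<kc = *-monoˡ-< c m<k
  mc≡kc : length (subsetsOfSize k (suc m)) ≡ 0 → m * c ≡ k * c
  mc≡kc c′≡0 = begin
    m * c                       ≡⟨ cong (_+ m * c) (*-zeroʳ (suc m)) ⟨
    suc m * 0 + m * c           ≡⟨ cong (λ c′ → suc m * c′ + m * c) c′≡0 ⟨
    suc m * length (subsetsOfSize k (suc m)) + m * c ≡⟨ length-subsetsOfSize-suc k m ⟩
    k * c                       ∎
    where open ≡-Reasoning

∑-insert-average : ∀ k m (ψ : Subset k → ℕ) → Antitone ψ →
  ∑ (subsetsOfSize k (suc m)) ψ * (k * length (subsetsOfSize k m))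
  ≤ length (subsetsOfSize k (suc m)) * ∑[ S ∈ subsetsOfSize k m ] ∑[ j ∈ allFin k ] ψ (⁅ j ⁆ ∪ S)
∑-insert-average k m ψ anti =
  subst (q′ * (k * c) ≤_)
    (cong (c′ *_) (sym (trans (∑-∑-insert k m ψ) (cong (m * q +_) (∑-∑∉-insert k m ψ)))))
    (ratio≤mediant m k q q′ c c′ q-bound (length-subsetsOfSize-suc k m))
  where
  q = ∑ (subsetsOfSize k m) ψ
  q′ = ∑ (subsetsOfSize k (suc m)) ψ
  c = length (subsetsOfSize k m)
  c′ = length (subsetsOfSize k (suc m))
  q-bound : suc m * q′ + m * q ≤ k * q
  q-bound = begin
    suc m * q′ + m * q
      ≡⟨ cong (_+ m * q) (∑-∑∉-insert k m ψ) ⟨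
    ∑[ S ∈ subsetsOfSize k m ] ∑[ j ∉ S ] ψ (⁅ j ⁆ ∪ S) + m * q
      ≤⟨ +-monoˡ-≤ (m * q) (∑-mono (subsetsOfSize k m) λ S →
           ∑-mono (allFin k) λ j → when-monoʳ (not (lookup S j)) (anti (q⊆p∪q ⁅ j ⁆ S))) ⟩
    ∑[ S ∈ subsetsOfSize k m ] ∑∉ S (const (ψ S)) + m * q
      ≡⟨ ∑-∑∉-const k m ψ ⟩
    k * q ∎
    where open ≤-Reasoning

image : ∀ {k n} → Vec (Fin k) n → Subset k
image f = ⋃ (map ⁅_⁆ (toList f))

classicalSum : ∀ k n → (Subset k → ℕ) → ℕ
classicalSum k n ψ = ∑[ f ∈ classicalOutcomes k n ] ψ (image f)

classicalSum-suc : ∀ k n (ψ : Subset k → ℕ) →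
  classicalSum k (suc n) ψ ≡ ∑[ j ∈ allFin k ] classicalSum k n (λ B → ψ (⁅ j ⁆ ∪ B))
classicalSum-suc k n ψ = trans (∑-concatMap _ (allFin k) _)
  (∑-cong (allFin k) (λ j → ∑-map (j ∷_) (classicalOutcomes k n) _))

classicalSum-+ : ∀ k m n (ψ : Subset k → ℕ) →
  classicalSum k (m + n) ψ ≡ classicalSum k m (λ B → classicalSum k n (λ C → ψ (B ∪ C)))
classicalSum-+ k zero    n ψ = trans
  (∑-cong (classicalOutcomes k n) (λ f → cong ψ (sym (∪-identityˡ (image f)))))
  (sym (+-identityʳ _))
classicalSum-+ k (suc m) n ψ = begin
  classicalSum k (suc (m + n)) ψ
    ≡⟨ classicalSum-suc k (m + n) ψ ⟩
  ∑[ j ∈ allFin k ] classicalSum k (m + n) (λ B → ψ (⁅ j ⁆ ∪ B))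
    ≡⟨ ∑-cong (allFin k) (λ j → classicalSum-+ k m n (λ B → ψ (⁅ j ⁆ ∪ B))) ⟩
  ∑[ j ∈ allFin k ] classicalSum k m (λ B → classicalSum k n (λ C → ψ (⁅ j ⁆ ∪ (B ∪ C))))
    ≡⟨ ∑-cong (allFin k) (λ j → ∑-cong (classicalOutcomes k m) λ f →
         ∑-cong (classicalOutcomes k n) λ g → cong ψ (∪-assoc ⁅ j ⁆ (image f) (image g))) ⟨
  ∑[ j ∈ allFin k ] classicalSum k m (λ B → classicalSum k n (λ C → ψ ((⁅ j ⁆ ∪ B) ∪ C)))
    ≡⟨ classicalSum-suc k m (λ B → classicalSum k n (λ C → ψ (B ∪ C))) ⟨
  classicalSum k (suc m) (λ B → classicalSum k n (λ C → ψ (B ∪ C))) ∎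
  where open ≡-Reasoning

classicalSum-antitone : ∀ k n {ψ : Subset k → ℕ} → Antitone ψ →
  Antitone (λ B → classicalSum k n (λ C → ψ (B ∪ C)))
classicalSum-antitone k n anti p⊆q =
  ∑-mono (classicalOutcomes k n) (λ f → anti (∪-mono-⊆ p⊆q (λ x∈ → x∈)))

length-classicalOutcomes : ∀ k n → length (classicalOutcomes k n) ≡ k ^ n
length-classicalOutcomes k zero    = refl
length-classicalOutcomes k (suc n) = begin
  length (classicalOutcomes k (suc n))   ≡⟨ ∑-1 (classicalOutcomes k (suc n)) ⟨
  classicalSum k (suc n) (const 1)       ≡⟨ classicalSum-suc k n (const 1) ⟩
  ∑[ j ∈ allFin k ] classicalSum k n (const 1)
    ≡⟨ ∑-cong (allFin k) (λ _ → trans (∑-1 (classicalOutcomes k n)) (length-classicalOutcomes k n)) ⟩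
  ∑[ j ∈ allFin k ] (k ^ n)              ≡⟨ ∑-const (allFin k) (k ^ n) ⟩
  length (allFin k) * k ^ n              ≡⟨ cong (_* k ^ n) (length-tabulate {n = k} id) ⟩
  k ^ suc n                              ∎
  where open ≡-Reasoning

subsetAverage≤classicalAverage : ∀ k m → m ≤ k → (ψ : Subset k → ℕ) → Antitone ψ →
  ∑ (subsetsOfSize k m) ψ * k ^ m ≤ length (subsetsOfSize k m) * classicalSum k m ψ
subsetAverage≤classicalAverage k zero    _   ψ _    = ≤-reflexive (begin
  ∑ (subsetsOfSize k 0) ψ * 1                     ≡⟨ *-identityʳ _ ⟩
  ∑ (subsetsOfSize k 0) ψ                         ≡⟨ ∑-subsetsOfSize-zero k ψ ⟩
  ψ ⊥                                             ≡⟨ +-identityʳ (ψ ⊥) ⟨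
  classicalSum k 0 ψ                              ≡⟨ *-identityˡ _ ⟨
  1 * classicalSum k 0 ψ                          ≡⟨ cong (_* classicalSum k 0 ψ) (length-subsetsOfSize-zero k) ⟨
  length (subsetsOfSize k 0) * classicalSum k 0 ψ ∎)
  where open ≡-Reasoning
subsetAverage≤classicalAverage k (suc m) m<k ψ anti = *-cancelˡ-≤ c (begin
  c * (q′ * (k * k ^ m))        ≡⟨ regroup c q′ k (k ^ m) ⟩
  q′ * (k * c) * k ^ m          ≤⟨ *-monoˡ-≤ (k ^ m) (∑-insert-average k m ψ anti) ⟩
  c′ * Q * k ^ m                ≡⟨ *-assoc c′ Q (k ^ m) ⟩
  c′ * (Q * k ^ m)              ≤⟨ *-monoʳ-≤ c′ Q≤ ⟩
  c′ * (c * classicalSum k (suc m) ψ) ≡⟨ x∙yz≈y∙xz c′ c _ ⟩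
  c * (c′ * classicalSum k (suc m) ψ) ∎)
  where
  open ≤-Reasoning
  c = length (subsetsOfSize k m)
  c′ = length (subsetsOfSize k (suc m))
  q′ = ∑ (subsetsOfSize k (suc m)) ψ
  Q = ∑[ S ∈ subsetsOfSize k m ] ∑[ j ∈ allFin k ] ψ (⁅ j ⁆ ∪ S)
  instance
    c≢0 : NonZero c
    c≢0 = >-nonZero (length-subsetsOfSize-pos k m (<⇒≤ m<k))
  regroup : ∀ c q′ k kᵐ → c * (q′ * (k * kᵐ)) ≡ q′ * (k * c) * kᵐ
  regroup = solve-∀
  Q≤ : Q * k ^ m ≤ c * classicalSum k (suc m) ψ
  Q≤ = begin
    Q * k ^ m
      ≡⟨ cong (_* k ^ m) (∑-comm (subsetsOfSize k m) (allFin k) _) ⟩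
    (∑[ j ∈ allFin k ] ∑[ S ∈ subsetsOfSize k m ] ψ (⁅ j ⁆ ∪ S)) * k ^ m
      ≡⟨ ∑-*ʳ (allFin k) (k ^ m) _ ⟨
    ∑[ j ∈ allFin k ] (∑[ S ∈ subsetsOfSize k m ] ψ (⁅ j ⁆ ∪ S) * k ^ m)
      ≤⟨ ∑-mono (allFin k) (λ j →
           subsetAverage≤classicalAverage k m (<⇒≤ m<k) (λ B → ψ (⁅ j ⁆ ∪ B))
             (antitone-∪ˡ anti ⁅ j ⁆)) ⟩
    ∑[ j ∈ allFin k ] (c * classicalSum k m (λ B → ψ (⁅ j ⁆ ∪ B)))
      ≡⟨ ∑-*ˡ (allFin k) c _ ⟩
    c * ∑[ j ∈ allFin k ] classicalSum k m (λ B → ψ (⁅ j ⁆ ∪ B))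
      ≡⟨ cong (c *_) (classicalSum-suc k m ψ) ⟨
    c * classicalSum k (suc m) ψ ∎

groupedSum : ∀ k {b} → Vec ℕ b → (Subset k → ℕ) → ℕ
groupedSum k s ψ = ∑[ o ∈ groupedOutcomes k s ] ψ (⋃ (toList o))

groupedSum-∷ : ∀ k {b} m (s : Vec ℕ b) (ψ : Subset k → ℕ) →
  groupedSum k (m ∷ s) ψ ≡ ∑[ S ∈ subsetsOfSize k m ] groupedSum k s (λ B → ψ (S ∪ B))
groupedSum-∷ k m s ψ = trans (∑-concatMap _ (subsetsOfSize k m) _)
  (∑-cong (subsetsOfSize k m) (λ S → ∑-map (S ∷_) (groupedOutcomes k s) _))

length-groupedOutcomes-∷ : ∀ k {b} m (s : Vec ℕ b) →
  length (groupedOutcomes k (m ∷ s)) ≡ length (subsetsOfSize k m) * length (groupedOutcomes k s)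
length-groupedOutcomes-∷ k m s = begin
  length (groupedOutcomes k (m ∷ s))
    ≡⟨ ∑-1 (groupedOutcomes k (m ∷ s)) ⟨
  groupedSum k (m ∷ s) (const 1)
    ≡⟨ groupedSum-∷ k m s (const 1) ⟩
  ∑[ _ ∈ subsetsOfSize k m ] groupedSum k s (const 1)
    ≡⟨ ∑-const (subsetsOfSize k m) _ ⟩
  length (subsetsOfSize k m) * groupedSum k s (const 1)
    ≡⟨ cong (length (subsetsOfSize k m) *_) (∑-1 (groupedOutcomes k s)) ⟩
  length (subsetsOfSize k m) * length (groupedOutcomes k s) ∎
  where open ≡-Reasoning

length-groupedOutcomes-pos : ∀ k {b} (s : Vec ℕ b) → All (_≤ k) s → 0 < length (groupedOutcomes k s)
length-groupedOutcomes-pos k []      []          = s≤s z≤n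
length-groupedOutcomes-pos k (m ∷ s) (m≤k ∷ s≤k) = subst (0 <_) (sym (length-groupedOutcomes-∷ k m s))
  (*-mono-≤ (length-subsetsOfSize-pos k m m≤k) (length-groupedOutcomes-pos k s s≤k))

groupedAverage≤classicalAverage : ∀ k {b} (s : Vec ℕ b) → All (_≤ k) s →
  (ψ : Subset k → ℕ) → Antitone ψ →
  groupedSum k s ψ * k ^ sum s ≤ length (groupedOutcomes k s) * classicalSum k (sum s) ψ
groupedAverage≤classicalAverage k []      []          ψ _    =
  ≤-reflexive (trans (*-identityʳ _) (sym (*-identityˡ _)))
groupedAverage≤classicalAverage k (m ∷ s) (m≤k ∷ s≤k) ψ anti = begin
  groupedSum k (m ∷ s) ψ * k ^ (m + n)
    ≡⟨ cong₂ _*_ (groupedSum-∷ k m s ψ) (^-distribˡ-+-* k m n) ⟩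
  ∑ Sₘ F * (k ^ m * k ^ n)
    ≡⟨ regroup (∑ Sₘ F) (k ^ m) (k ^ n) ⟩
  ∑ Sₘ F * k ^ n * k ^ m
    ≡⟨ cong (_* k ^ m) (∑-*ʳ Sₘ (k ^ n) F) ⟨
  ∑[ S ∈ Sₘ ] (F S * k ^ n) * k ^ m
    ≤⟨ *-monoˡ-≤ (k ^ m) (∑-mono Sₘ λ S →
         groupedAverage≤classicalAverage k s s≤k (λ B → ψ (S ∪ B)) (antitone-∪ˡ anti S)) ⟩
  ∑[ S ∈ Sₘ ] (g * φ S) * k ^ m
    ≡⟨ cong (_* k ^ m) (∑-*ˡ Sₘ g φ) ⟩
  g * ∑ Sₘ φ * k ^ m
    ≡⟨ *-assoc g (∑ Sₘ φ) (k ^ m) ⟩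
  g * (∑ Sₘ φ * k ^ m)
    ≤⟨ *-monoʳ-≤ g (subsetAverage≤classicalAverage k m m≤k φ (classicalSum-antitone k n anti)) ⟩
  g * (length Sₘ * classicalSum k m φ)
    ≡⟨ x∙yz≈y∙xz g (length Sₘ) (classicalSum k m φ) ⟩
  length Sₘ * (g * classicalSum k m φ)
    ≡⟨ *-assoc (length Sₘ) g (classicalSum k m φ) ⟨
  length Sₘ * g * classicalSum k m φ
    ≡⟨ cong₂ _*_ (length-groupedOutcomes-∷ k m s) (classicalSum-+ k m n ψ) ⟨
  length (groupedOutcomes k (m ∷ s)) * classicalSum k (m + n) ψ ∎
  where
  open ≤-Reasoning
  n = sum s
  Sₘ = subsetsOfSize k m
  g = length (groupedOutcomes k s)
  F φ : Subset k → ℕ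
  F S = groupedSum k s (λ B → ψ (S ∪ B))
  φ B = classicalSum k n (λ C → ψ (B ∪ C))
  regroup : ∀ x y z → x * (y * z) ≡ x * z * y
  regroup = solve-∀

not-∨ : ∀ a b → not (a ∨ b) ≡ not a ∧ not b
not-∨ true  _ = refl
not-∨ false _ = refl

countᵇ-cong : ∀ {A : Set} (L : List A) {p q : A → Bool} → (∀ x → p x ≡ q x) → countᵇ p L ≡ countᵇ q L
countᵇ-cong L {p} {q} p≗q =
  trans (countᵇ≡∑ p L) (trans (∑-cong L (λ x → cong (λ b → when b 1) (p≗q x))) (sym (countᵇ≡∑ q L)))

countᵇ-lookup : ∀ {k} (p : Subset k) → countᵇ (lookup p) (allFin k) ≡ ∣ p ∣
countᵇ-lookup {k} p = trans (countᵇ≡∑ (lookup p) (allFin k)) (trans (∑∈-const p 1) (*-identityʳ ∣ p ∣))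

countᵇ-not-lookup : ∀ {k} (p : Subset k) → countᵇ (λ j → not (lookup p j)) (allFin k) ≡ ∣ ∁ p ∣
countᵇ-not-lookup {k} p =
  trans (countᵇ-cong (allFin k) (λ j → sym (Vec.lookup-map j not p))) (countᵇ-lookup (∁ p))

emptyGrouped≡∣∁⋃∣ : ∀ {k b} (o : Vec (Subset k) b) → emptyGrouped o ≡ ∣ ∁ (⋃ (toList o)) ∣
emptyGrouped≡∣∁⋃∣ {k} o = trans (countᵇ-cong (allFin k) (allOutside o)) (countᵇ-not-lookup (⋃ (toList o)))
  where
  allOutside : ∀ {b} (o : Vec (Subset k) b) j →
    foldr _ (λ S acc → not (lookup S j) ∧ acc) true o ≡ not (lookup (⋃ (toList o)) j)
  allOutside []      j = cong not (sym (lookup-⊥ j))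
  allOutside (S ∷ o) j = begin
    not (lookup S j) ∧ foldr _ (λ S acc → not (lookup S j) ∧ acc) true o
      ≡⟨ cong (not (lookup S j) ∧_) (allOutside o j) ⟩
    not (lookup S j) ∧ not (lookup (⋃ (toList o)) j)
      ≡⟨ not-∨ (lookup S j) _ ⟨
    not (lookup S j ∨ lookup (⋃ (toList o)) j)
      ≡⟨ cong not (lookup-∪ S _ j) ⟨
    not (lookup (S ∪ ⋃ (toList o)) j) ∎
    where open ≡-Reasoning

emptyClassical≡∣∁image∣ : ∀ {k n} (f : Vec (Fin k) n) → emptyClassical f ≡ ∣ ∁ (image f) ∣
emptyClassical≡∣∁image∣ {k} f = trans (countᵇ-cong (allFin k) (allMissed f)) (countᵇ-not-lookup (image f))
  where
  allMissed : ∀ {n} (f : Vec (Fin k) n) j →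
    foldr _ (λ u acc → not ⌊ u Fin.≟ j ⌋ ∧ acc) true f ≡ not (lookup (image f) j)
  allMissed []      j = cong not (sym (lookup-⊥ j))
  allMissed (u ∷ f) j = begin
    not ⌊ u Fin.≟ j ⌋ ∧ foldr _ (λ u acc → not ⌊ u Fin.≟ j ⌋ ∧ acc) true f
      ≡⟨ cong (not ⌊ u Fin.≟ j ⌋ ∧_) (allMissed f j) ⟩
    not ⌊ u Fin.≟ j ⌋ ∧ not (lookup (image f) j)
      ≡⟨ not-∨ ⌊ u Fin.≟ j ⌋ _ ⟨
    not (⌊ u Fin.≟ j ⌋ ∨ lookup (image f) j)
      ≡⟨ cong (λ b → not (b ∨ lookup (image f) j)) (lookup-⁅⁆ u j) ⟨
    not (lookup ⁅ u ⁆ j ∨ lookup (image f) j)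
      ≡⟨ cong not (lookup-∪ ⁅ u ⁆ _ j) ⟨
    not (lookup (image (u ∷ f)) j) ∎
    where open ≡-Reasoning

atLeastEmpty : ∀ {k} → ℕ → Subset k → ℕ
atLeastEmpty t B = when (t ≤ᵇ ∣ ∁ B ∣) 1

atLeastEmpty-antitone : ∀ {k} t → Antitone (atLeastEmpty {k} t)
atLeastEmpty-antitone t p⊆q = threshold-mono (p⊆q⇒∣p∣≤∣q∣ (p⊆q⇒∁p⊇∁q p⊆q))
  where
  threshold-mono : ∀ {x y} → x ≤ y → when (t ≤ᵇ x) 1 ≤ when (t ≤ᵇ y) 1
  threshold-mono {x} {y} x≤y with t ≤ᵇ x in t≤ᵇx
  ... | false = z≤n
  ... | true with t ≤ᵇ y | ≤⇒≤ᵇ (≤-trans (≤ᵇ⇒≤ t x (subst T (sym t≤ᵇx) _)) x≤y)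
  ...   | true  | _  = ≤-refl
  ...   | false | ()

countᵇ-grouped : ∀ k {b} (s : Vec ℕ b) t →
  countᵇ (λ o → t ≤ᵇ emptyGrouped o) (groupedOutcomes k s) ≡ groupedSum k s (atLeastEmpty t)
countᵇ-grouped k s t = trans (countᵇ≡∑ _ (groupedOutcomes k s))
  (∑-cong (groupedOutcomes k s) (λ o → cong (λ e → when (t ≤ᵇ e) 1) (emptyGrouped≡∣∁⋃∣ o)))

countᵇ-classical : ∀ k n t →
  countᵇ (λ f → t ≤ᵇ emptyClassical f) (classicalOutcomes k n) ≡ classicalSum k n (atLeastEmpty t)
countᵇ-classical k n t = trans (countᵇ≡∑ _ (classicalOutcomes k n))
  (∑-cong (classicalOutcomes k n) (λ f → cong (λ e → when (t ≤ᵇ e) 1) (emptyClassical≡∣∁image∣ f)))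

cross-≤⇒/≤/ : ∀ a b x y → a * suc y ≤ b * suc x → ℤ.+ a / suc x ≤ℚ ℤ.+ b / suc y
cross-≤⇒/≤/ a b x y h = ℚ.toℚᵘ-cancel-≤
  (ℚᵘ.≤-respʳ-≃ (ℚᵘ.≃-sym (ℚ.toℚᵘ-fromℚᵘ (mkℚᵘ (ℤ.+ b) y)))
    (ℚᵘ.≤-respˡ-≃ (ℚᵘ.≃-sym (ℚ.toℚᵘ-fromℚᵘ (mkℚᵘ (ℤ.+ a) x)))
      (*≤* (subst₂ ℤ._≤_ (ℤ.pos-* a (suc y)) (ℤ.pos-* b (suc x)) (ℤ.+≤+ h)))))

probU-≤ : ∀ {A B : Set} (L : List A) (M : List B) (P : A → Bool) (Q : B → Bool) →
  0 < length L → 0 < length M → countᵇ P L * length M ≤ countᵇ Q M * length L → probU L P ≤ℚ probU M Q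
probU-≤ L M P Q L>0 M>0 h with length L | length M
... | suc x | suc y = cross-≤⇒/≤/ (countᵇ P L) (countᵇ Q M) x y h

lemma2 : (k : ℕ) → 1 ≤ k → (b : ℕ) → (s : Vec ℕ b) → All (_≤ k) s → (t : ℕ) →
    PrX≥ k s t ≤ℚ PrY≥ k (sum s) t
lemma2 k k≥1 b s s≤k t = probU-≤ grouped classical _ _
  (length-groupedOutcomes-pos k s s≤k)
  (subst (0 <_) (sym (length-classicalOutcomes k (sum s))) (m^n>0 k (sum s)))
  (begin
    countᵇ _ grouped * length classical
      ≡⟨ cong₂ _*_ (countᵇ-grouped k s t) (length-classicalOutcomes k (sum s)) ⟩
    groupedSum k s ψ * k ^ sum s
      ≤⟨ groupedAverage≤classicalAverage k s s≤k ψ (atLeastEmpty-antitone t) ⟩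
    length grouped * classicalSum k (sum s) ψ
      ≡⟨ *-comm (length grouped) _ ⟩
    classicalSum k (sum s) ψ * length grouped
      ≡⟨ cong (_* length grouped) (countᵇ-classical k (sum s) t) ⟨
    countᵇ _ classical * length grouped ∎)
  where
  open ≤-Reasoning
  instance
    k≢0 : NonZero k
    k≢0 = >-nonZero k≥1
  grouped = groupedOutcomes k s
  classical = classicalOutcomes k (sum s)
  ψ : Subset k → ℕ
  ψ = atLeastEmpty t
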